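{- Let $p,q\geq 0$, $t\in Y_p$ and $w\in Y_q$. In $\mathbf{Q}[Y_\infty]$ one has $$t*w=\sum_{u\in Y_{p+q},\ t/w\leq u\leq t\backslash w}u ,$$ where $\leq$ is the weak order on $Y_{p+q}$.
   Context: For $n\geq0$, $Y_n$ is the set of planar binary rooted trees with $n$ internal vertices ($Y_0=\{|\}$, the tree with one leaf and no vertex). The grafting $u\vee v\in Y_{p+q+1}$ of $u\in Y_p$, $v\in Y_q$ is obtained by joining the roots of $u$ and $v$ to a new vertex (with $u$ on the left) and adding a new root; every $t\in Y_n$, $n\geq1$, is uniquely $t=t^l\vee t^r$. The weak order $\leq$ on $Y_n$ is the partial order generated (reflexively and transitively) by: (a) if $u\leq u'$ in $Y_p$ and $v\leq v'$ in $Y_q$ then $u\vee v\leq u'\vee v'$; (b) $(u\vee v)\vee w\leq u\vee(v\vee w)$ for all trees $u,v,w$. Over and under, $Y_p\times Y_q\to Y_{p+q}$: $u/v$ is obtained by identifying the root of $u$ with the leftmost leaf of $v$, and $u\backslash v$ by identifying the rightmost leaf of $u$ with the root of $v$; recursively $t/|=t=|\backslash t$, $t\backslash|=t=|/t$, $u/v=(u/v^l)\vee v^r$, $u\backslash v=u^l\vee(u^r\backslash v)$. $\mathbf{Q}[Y_\infty]=\bigoplus_{n\ge0}\mathbf{Q}[Y_n]$ has the product defined recursively by $t*|=|*t=t$ and, for $t=t^l\vee t^r$, $w=w^l\vee w^r$, $t*w=(t*w^l)\vee w^r+t^l\vee(t^r*w)$, with $\vee$ extended bilinearly. -}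

module Defs where

open import Data.Nat using (ℕ; zero; suc; _+_)
open import Data.Rational using (ℚ; 0ℚ; 1ℚ) renaming (_+_ to _+ℚ_)
open import Data.List using (List; []; _∷_; _++_; map)
open import Data.Product using (_×_; _,_)
open import Relation.Nullary using (Dec; yes; no)
open import Relation.Binary.PropositionalEquality using (_≡_; refl; cong₂)

-- Planar binary rooted trees: leaf = | , node u v = u ∨ v.
data Tree : Set where
  leaf : Tree
  _∨_  : Tree → Tree → Tree

infixr 6 _∨_

-- number of internal vertices; t ∈ Y_n  iff  size t ≡ n
size : Tree → ℕ
size leaf = zero
size (u ∨ v) = suc (size u + size v)

_≟T_ : (s t : Tree) → Dec (s ≡ t)
leaf ≟T leaf = yes refl
leaf ≟T (_ ∨ _) = no (λ ())
(_ ∨ _) ≟T leaf = no (λ ())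
(a ∨ b) ≟T (c ∨ d) with a ≟T c | b ≟T d
... | yes p | yes q = yes (cong₂ _∨_ p q)
... | no ¬p | _ = no (λ { refl → ¬p refl })
... | yes _ | no ¬q = no (λ { refl → ¬q refl })

data _≤w_ : Tree → Tree → Set where
  ≤w-refl  : ∀ {t} → t ≤w t
  ≤w-trans : ∀ {s t u} → s ≤w t → t ≤w u → s ≤w u
  ≤w-graft : ∀ {u u' v v'} → u ≤w u' → v ≤w v' → (u ∨ v) ≤w (u' ∨ v')
  ≤w-assoc : ∀ {u v w} → ((u ∨ v) ∨ w) ≤w (u ∨ (v ∨ w))

_/_ : Tree → Tree → Tree
u / leaf = u
u / (vl ∨ vr) = (u / vl) ∨ vr

_\\_ : Tree → Tree → Tree
leaf \\ v = v
(ul ∨ ur) \\ v = ul ∨ (ur \\ v)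

-- Elements of Q[Y_∞]: finite formal Q-linear combinations of trees,
-- represented by a list of (coefficient, tree) pairs.
QY : Set
QY = List (ℚ × Tree)

coeff : QY → Tree → ℚ
coeff [] u = 0ℚ
coeff ((c , s) ∷ xs) u with s ≟T u
... | yes _ = c +ℚ coeff xs u
... | no _  = coeff xs u

_∨ₗ_ : QY → Tree → QY
xs ∨ₗ b = map (λ { (c , a) → (c , a ∨ b) }) xs

_∨ᵣ_ : Tree → QY → QY
a ∨ᵣ xs = map (λ { (c , b) → (c , a ∨ b) }) xs

_*_ : Tree → Tree → QY
t * leaf = (1ℚ , t) ∷ []
leaf * w@(_ ∨ _) = (1ℚ , w) ∷ []
t@(tl ∨ tr) * w@(wl ∨ wr) = ((t * wl) ∨ₗ wr) ++ (tl ∨ᵣ (tr * w))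

InInterval : Tree → Tree → Tree → Set
InInterval t w u = (size u ≡ size t + size w) × ((t / w) ≤w u) × (u ≤w (t \\ w))

-- Label the internal vertices of a tree u of size p + q by 1, …, p + q in in-order, and restrict u to
-- its first p and its last q labels; call u a splitting of (t, w) when these restrictions are t and w.
-- The recursion defining t * w decides whether the root of u belongs to the w-part (first summand) or
-- to the t-part (second summand), so by induction t * w is exactly the sum of the splittings of (t, w).
-- Restriction is monotone for the weak order, t / w and t \ w are splittings of (t, w), and the weak
-- order is antisymmetric (summing the sizes of all right subtrees gives a potential that strictly
-- increases at every associativity step); hence every tree of the interval [t / w , t \ w] is a
-- splitting. Conversely, grafting a splitting as in the recursion keeps it between the corresponding
-- over and under products.

module Submission where

open import Defs
open import Data.Empty using (⊥-elim)
open import Data.List using ([]; _∷_; _++_; map)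
open import Data.Nat using (ℕ; zero; suc; _+_; _∸_; _≤_; _<_; z≤n; s≤s; _≤?_)
open import Data.Nat.Properties
  using ( +-suc; +-assoc; +-comm; +-identityʳ; +-cancelˡ-≡; +-cancelʳ-≡; +-cancelʳ-≤; +-mono-≤; +-monoʳ-≤
        ; ≤-refl; ≤-trans; ≤-antisym; ≤-reflexive; <⇒≤; <-irrefl; n≮n; suc-injective
        ; m≤m+n; m≤n+m; m≤n⇒m≤1+n; m+n≮m; m+n∸m≡n; m≢1+m+n )
open import Data.Nat.Tactic.RingSolver using (solve-∀)
open import Data.Product using (∃-syntax; _×_; _,_; map₂)
open import Data.Rational using (ℚ; 0ℚ; 1ℚ) renaming (_+_ to _+ℚ_)
import Data.Rational.Properties as ℚ
open import Data.Sum using (_⊎_; inj₁; inj₂)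
open import Function using (_∘_; _$_)
open import Function.Bundles using (_⇔_; mk⇔; module Equivalence)
open import Function.Definitions using (Injective)
open import Relation.Nullary using (¬_; Dec; yes; no)
open import Relation.Binary.PropositionalEquality
  using (_≡_; _≢_; refl; sym; trans; cong; cong₂; subst; subst₂; module ≡-Reasoning)

open Equivalence using (to; from)

∨-injectiveˡ : ∀ {a b c d} → a ∨ b ≡ c ∨ d → a ≡ c
∨-injectiveˡ refl = refl

∨-injectiveʳ : ∀ {a b c d} → a ∨ b ≡ c ∨ d → b ≡ d
∨-injectiveʳ refl = refl

+-suc-+ : ∀ m n o → m + suc (n + o) ≡ suc (m + n + o)
+-suc-+ m n o = trans (+-suc m (n + o)) (cong suc (sym (+-assoc m n o)))

size-/ : ∀ t w → size (t / w) ≡ size t + size w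
size-/ t leaf = sym (+-identityʳ (size t))
size-/ t (a ∨ b) =
  trans (cong (λ n → suc (n + size b)) (size-/ t a)) (sym (+-suc-+ (size t) (size a) (size b)))

size-\\ : ∀ t w → size (t \\ w) ≡ size t + size w
size-\\ leaf w = refl
size-\\ (a ∨ b) w =
  cong suc (trans (cong (size a +_) (size-\\ b w)) (sym (+-assoc (size a) (size b) (size w))))

leaf-/ : ∀ w → leaf / w ≡ w
leaf-/ leaf = refl
leaf-/ (a ∨ b) = cong (_∨ b) (leaf-/ a)

\\-leaf : ∀ t → t \\ leaf ≡ t
\\-leaf leaf = refl
\\-leaf (a ∨ b) = cong (a ∨_) (\\-leaf b)

≤w-reflexive : ∀ {s t} → s ≡ t → s ≤w t
≤w-reflexive refl = ≤w-refl

≤w-size : ∀ {s t} → s ≤w t → size s ≡ size t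
≤w-size ≤w-refl = refl
≤w-size (≤w-trans p q) = trans (≤w-size p) (≤w-size q)
≤w-size (≤w-graft p q) = cong suc (cong₂ _+_ (≤w-size p) (≤w-size q))
≤w-size (≤w-assoc {u} {v} {w}) = cong suc (sym (+-suc-+ (size u) (size v) (size w)))

∨-/-≤w : ∀ a b y → ((a ∨ b) / y) ≤w (a ∨ (b / y))
∨-/-≤w a b leaf = ≤w-refl
∨-/-≤w a b (c ∨ d) = ≤w-trans (≤w-graft (∨-/-≤w a b c) ≤w-refl) ≤w-assoc

\\-∨-≤w : ∀ x a b → ((x \\ a) ∨ b) ≤w (x \\ (a ∨ b))
\\-∨-≤w leaf a b = ≤w-refl
\\-∨-≤w (xl ∨ xr) a b = ≤w-trans ≤w-assoc (≤w-graft ≤w-refl (\\-∨-≤w xr a b))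

rightWeight : Tree → ℕ
rightWeight leaf = 0
rightWeight (u ∨ v) = rightWeight u + rightWeight v + size v

rightWeight-assoc-< : ∀ u v w → rightWeight ((u ∨ v) ∨ w) < rightWeight (u ∨ (v ∨ w))
rightWeight-assoc-< u v w =
  subst (rightWeight ((u ∨ v) ∨ w) <_)
    (sym (identity (rightWeight u) (rightWeight v) (rightWeight w) (size v) (size w)))
    (s≤s (m≤m+n _ (size w)))
  where
  identity : ∀ a b c m n → a + (b + c + n) + suc (m + n) ≡ suc (a + b + m + c + n + n)
  identity = solve-∀

rightWeight-mono : ∀ {s t} → s ≤w t → rightWeight s ≤ rightWeight t
rightWeight-mono ≤w-refl = ≤-refl
rightWeight-mono (≤w-trans p q) = ≤-trans (rightWeight-mono p) (rightWeight-mono q)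
rightWeight-mono (≤w-graft p q) =
  +-mono-≤ (+-mono-≤ (rightWeight-mono p) (rightWeight-mono q)) (≤-reflexive (≤w-size q))
rightWeight-mono (≤w-assoc {u} {v} {w}) = <⇒≤ (rightWeight-assoc-< u v w)

+-≤-≡⇒≡ : ∀ {m n o p} → m ≤ n → o ≤ p → m + o ≡ n + p → m ≡ n × o ≡ p
+-≤-≡⇒≡ {m} {n} {o} {p} m≤n o≤p eq = m≡n , +-cancelˡ-≡ m o p (trans eq (cong (_+ p) (sym m≡n)))
  where
  m≡n : m ≡ n
  m≡n = ≤-antisym m≤n (+-cancelʳ-≤ p n m (subst (_≤ m + p) eq (+-monoʳ-≤ m o≤p)))

≤w-rightWeight-≡⇒≡ : ∀ {s t} → s ≤w t → rightWeight s ≡ rightWeight t → s ≡ t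
≤w-rightWeight-≡⇒≡ ≤w-refl _ = refl
≤w-rightWeight-≡⇒≡ {s} {t} (≤w-trans {t = m} p q) eq =
  trans (≤w-rightWeight-≡⇒≡ p s≡m) (≤w-rightWeight-≡⇒≡ q (trans (sym s≡m) eq))
  where
  s≡m : rightWeight s ≡ rightWeight m
  s≡m = ≤-antisym (rightWeight-mono p) (subst (rightWeight m ≤_) (sym eq) (rightWeight-mono q))
≤w-rightWeight-≡⇒≡ (≤w-graft {u} {u'} {v} {v'} p q) eq with
  +-≤-≡⇒≡ (rightWeight-mono p) (rightWeight-mono q)
    (+-cancelʳ-≡ (size v') _ _ (subst (λ n → rightWeight u + rightWeight v + n ≡ _) (≤w-size q) eq))
... | u≡u' , v≡v' = cong₂ _∨_ (≤w-rightWeight-≡⇒≡ p u≡u') (≤w-rightWeight-≡⇒≡ q v≡v')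
≤w-rightWeight-≡⇒≡ (≤w-assoc {u} {v} {w}) eq = ⊥-elim (<-irrefl eq (rightWeight-assoc-< u v w))

≤w-antisym : ∀ {s t} → s ≤w t → t ≤w s → s ≡ t
≤w-antisym p q = ≤w-rightWeight-≡⇒≡ p (≤-antisym (rightWeight-mono p) (rightWeight-mono q))

data Position (k n : ℕ) : Set where
  within : k ≤ n → Position k n
  beyond : ∀ j → k ≡ suc (n + j) → Position k n

position : ∀ k n → Position k n
position zero n = within z≤n
position (suc k) zero = beyond k refl
position (suc k) (suc n) with position k n
... | within k≤n = within (s≤s k≤n)
... | beyond j eq = beyond j (cong suc eq)

-- Reading u as a binary search tree on its in-order labels, prefix k u and suffix k u are the
-- restrictions of u to its k smallest and its k largest labels.
prefix : ℕ → Tree → Tree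
prefix k leaf = leaf
prefix k (a ∨ b) with k ≤? size a
... | yes _ = prefix k a
... | no _  = a ∨ prefix (k ∸ suc (size a)) b

suffix : ℕ → Tree → Tree
suffix k leaf = leaf
suffix k (a ∨ b) with k ≤? size b
... | yes _ = suffix k b
... | no _  = suffix (k ∸ suc (size b)) a ∨ b

prefix-within : ∀ {k} a b → k ≤ size a → prefix k (a ∨ b) ≡ prefix k a
prefix-within {k} a b k≤a with k ≤? size a
... | yes _ = refl
... | no k≰a = ⊥-elim (k≰a k≤a)

prefix-beyond : ∀ {k} a b j → k ≡ suc (size a + j) → prefix k (a ∨ b) ≡ a ∨ prefix j b
prefix-beyond a b j refl with suc (size a + j) ≤? size a
... | yes a+j<a = ⊥-elim (m+n≮m (size a) j a+j<a)
... | no _ = cong (λ k → a ∨ prefix k b) (m+n∸m≡n (size a) j)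

suffix-within : ∀ {k} a b → k ≤ size b → suffix k (a ∨ b) ≡ suffix k b
suffix-within {k} a b k≤b with k ≤? size b
... | yes _ = refl
... | no k≰b = ⊥-elim (k≰b k≤b)

suffix-beyond : ∀ {k} a b j → k ≡ suc (size b + j) → suffix k (a ∨ b) ≡ suffix j a ∨ b
suffix-beyond a b j refl with suc (size b + j) ≤? size b
... | yes b+j<b = ⊥-elim (m+n≮m (size b) j b+j<b)
... | no _ = cong (λ k → suffix k a ∨ b) (m+n∸m≡n (size b) j)

prefix-zero : ∀ u → prefix 0 u ≡ leaf
prefix-zero leaf = refl
prefix-zero (a ∨ b) = trans (prefix-within a b z≤n) (prefix-zero a)

suffix-zero : ∀ u → suffix 0 u ≡ leaf
suffix-zero leaf = refl
suffix-zero (a ∨ b) = trans (suffix-within a b z≤n) (suffix-zero b)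

prefix-size : ∀ u → prefix (size u) u ≡ u
prefix-size leaf = refl
prefix-size (a ∨ b) = trans (prefix-beyond a b (size b) refl) (cong (a ∨_) (prefix-size b))

suffix-size : ∀ u → suffix (size u) u ≡ u
suffix-size leaf = refl
suffix-size (a ∨ b) =
  trans (suffix-beyond a b (size a) (cong suc (+-comm (size a) (size b)))) (cong (_∨ b) (suffix-size a))

prefix-/ : ∀ t w → prefix (size t) (t / w) ≡ t
prefix-/ t leaf = prefix-size t
prefix-/ t (a ∨ b) =
  trans (prefix-within (t / a) b (subst (size t ≤_) (sym (size-/ t a)) (m≤m+n _ _))) (prefix-/ t a)

prefix-\\ : ∀ t w → prefix (size t) (t \\ w) ≡ t
prefix-\\ leaf w = prefix-zero w
prefix-\\ (a ∨ b) w = trans (prefix-beyond a (b \\ w) (size b) refl) (cong (a ∨_) (prefix-\\ b w))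

suffix-/ : ∀ t w → suffix (size w) (t / w) ≡ w
suffix-/ t leaf = suffix-zero t
suffix-/ t (a ∨ b) =
  trans (suffix-beyond (t / a) b (size a) (cong suc (+-comm (size a) (size b)))) (cong (_∨ b) (suffix-/ t a))

suffix-\\ : ∀ t w → suffix (size w) (t \\ w) ≡ w
suffix-\\ leaf w = suffix-size w
suffix-\\ (a ∨ b) w =
  trans (suffix-within a (b \\ w) (subst (size w ≤_) (sym (size-\\ b w)) (m≤n+m _ _))) (suffix-\\ b w)

prefix-assoc-≤w : ∀ k a b c → prefix k ((a ∨ b) ∨ c) ≤w prefix k (a ∨ (b ∨ c))
prefix-assoc-≤w k a b c with position k (size a)
... | within k≤a = ≤w-reflexive (begin
  prefix k ((a ∨ b) ∨ c)  ≡⟨ prefix-within (a ∨ b) c (m≤n⇒m≤1+n (≤-trans k≤a (m≤m+n _ _))) ⟩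
  prefix k (a ∨ b)        ≡⟨ prefix-within a b k≤a ⟩
  prefix k a              ≡⟨ prefix-within a (b ∨ c) k≤a ⟨
  prefix k (a ∨ (b ∨ c))  ∎)
  where open ≡-Reasoning
... | beyond j eq with position j (size b)
...   | within j≤b = ≤w-reflexive (begin
  prefix k ((a ∨ b) ∨ c)  ≡⟨ prefix-within (a ∨ b) c k≤a∨b ⟩
  prefix k (a ∨ b)        ≡⟨ prefix-beyond a b j eq ⟩
  a ∨ prefix j b          ≡⟨ cong (a ∨_) (prefix-within b c j≤b) ⟨
  a ∨ prefix j (b ∨ c)    ≡⟨ prefix-beyond a (b ∨ c) j eq ⟨
  prefix k (a ∨ (b ∨ c))  ∎)
  where
  open ≡-Reasoning
  k≤a∨b : k ≤ size (a ∨ b)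
  k≤a∨b = subst (_≤ size (a ∨ b)) (sym eq) (s≤s (+-monoʳ-≤ (size a) j≤b))
...   | beyond i eq′ = subst₂ _≤w_
  (sym (prefix-beyond (a ∨ b) c i k≡))
  (sym (trans (prefix-beyond a (b ∨ c) j eq) (cong (a ∨_) (prefix-beyond b c i eq′))))
  ≤w-assoc
  where
  k≡ : k ≡ suc (size (a ∨ b) + i)
  k≡ = trans eq (cong suc (trans (cong (size a +_) eq′) (+-suc-+ (size a) (size b) i)))

suffix-assoc-≤w : ∀ k a b c → suffix k ((a ∨ b) ∨ c) ≤w suffix k (a ∨ (b ∨ c))
suffix-assoc-≤w k a b c with position k (size c)
... | within k≤c = ≤w-reflexive (begin
  suffix k ((a ∨ b) ∨ c)  ≡⟨ suffix-within (a ∨ b) c k≤c ⟩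
  suffix k c              ≡⟨ suffix-within b c k≤c ⟨
  suffix k (b ∨ c)        ≡⟨ suffix-within a (b ∨ c) (m≤n⇒m≤1+n (≤-trans k≤c (m≤n+m _ _))) ⟨
  suffix k (a ∨ (b ∨ c))  ∎)
  where open ≡-Reasoning
... | beyond j eq with position j (size b)
...   | within j≤b = ≤w-reflexive (begin
  suffix k ((a ∨ b) ∨ c)  ≡⟨ suffix-beyond (a ∨ b) c j eq ⟩
  suffix j (a ∨ b) ∨ c    ≡⟨ cong (_∨ c) (suffix-within a b j≤b) ⟩
  suffix j b ∨ c          ≡⟨ suffix-beyond b c j eq ⟨
  suffix k (b ∨ c)        ≡⟨ suffix-within a (b ∨ c) k≤b∨c ⟨
  suffix k (a ∨ (b ∨ c))  ∎)
  where
  open ≡-Reasoning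
  k≤b∨c : k ≤ size (b ∨ c)
  k≤b∨c = subst (_≤ size (b ∨ c)) (sym eq)
    (s≤s (subst (size c + j ≤_) (+-comm (size c) (size b)) (+-monoʳ-≤ (size c) j≤b)))
...   | beyond i eq′ = subst₂ _≤w_
  (sym (trans (suffix-beyond (a ∨ b) c j eq) (cong (_∨ c) (suffix-beyond a b i eq′))))
  (sym (suffix-beyond a (b ∨ c) i k≡))
  ≤w-assoc
  where
  identity : ∀ m n o → m + suc (n + o) ≡ suc (n + m + o)
  identity = solve-∀
  k≡ : k ≡ suc (size (b ∨ c) + i)
  k≡ = trans eq (cong suc (trans (cong (size c +_) eq′) (identity (size c) (size b) i)))

prefix-mono : ∀ k {s t} → s ≤w t → prefix k s ≤w prefix k t
prefix-mono k ≤w-refl = ≤w-refl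
prefix-mono k (≤w-trans p q) = ≤w-trans (prefix-mono k p) (prefix-mono k q)
prefix-mono k (≤w-assoc {a} {b} {c}) = prefix-assoc-≤w k a b c
prefix-mono k (≤w-graft {u} {u′} {v} {v′} p q) with position k (size u)
... | within k≤u = subst₂ _≤w_
  (sym (prefix-within u v k≤u))
  (sym (prefix-within u′ v′ (subst (k ≤_) (≤w-size p) k≤u)))
  (prefix-mono k p)
... | beyond j eq = subst₂ _≤w_
  (sym (prefix-beyond u v j eq))
  (sym (prefix-beyond u′ v′ j (subst (λ n → k ≡ suc (n + j)) (≤w-size p) eq)))
  (≤w-graft p (prefix-mono j q))

suffix-mono : ∀ k {s t} → s ≤w t → suffix k s ≤w suffix k t
suffix-mono k ≤w-refl = ≤w-refl
suffix-mono k (≤w-trans p q) = ≤w-trans (suffix-mono k p) (suffix-mono k q)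
suffix-mono k (≤w-assoc {a} {b} {c}) = suffix-assoc-≤w k a b c
suffix-mono k (≤w-graft {u} {u′} {v} {v′} p q) with position k (size v)
... | within k≤v = subst₂ _≤w_
  (sym (suffix-within u v k≤v))
  (sym (suffix-within u′ v′ (subst (k ≤_) (≤w-size q) k≤v)))
  (suffix-mono k q)
... | beyond j eq = subst₂ _≤w_
  (sym (suffix-beyond u v j eq))
  (sym (suffix-beyond u′ v′ j (subst (λ n → k ≡ suc (n + j)) (≤w-size q) eq)))
  (≤w-graft (suffix-mono j p) q)

record Splits (t w u : Tree) : Set where
  constructor splits
  field
    size≡   : size u ≡ size t + size w
    prefix≡ : prefix (size t) u ≡ t
    suffix≡ : suffix (size w) u ≡ w

Splits-leafʳ : ∀ {t u} → Splits t leaf u ⇔ t ≡ u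
Splits-leafʳ {t} {u} =
  mk⇔ split⇒≡ (λ { refl → splits (sym (+-identityʳ _)) (prefix-size t) (suffix-zero t) })
  where
  split⇒≡ : Splits t leaf u → t ≡ u
  split⇒≡ (splits size≡ prefix≡ _) = begin
    t                   ≡⟨ prefix≡ ⟨
    prefix (size t) u   ≡⟨ cong (λ k → prefix k u) (sym (trans size≡ (+-identityʳ _))) ⟩
    prefix (size u) u   ≡⟨ prefix-size u ⟩
    u                   ∎
    where open ≡-Reasoning

Splits-leafˡ : ∀ {w u} → Splits leaf w u ⇔ w ≡ u
Splits-leafˡ {w} {u} = mk⇔ split⇒≡ (λ { refl → splits refl (prefix-zero w) (suffix-size w) })
  where
  split⇒≡ : Splits leaf w u → w ≡ u
  split⇒≡ (splits size≡ _ suffix≡) = begin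
    w                   ≡⟨ suffix≡ ⟨
    suffix (size w) u   ≡⟨ cong (λ k → suffix k u) size≡ ⟨
    suffix (size u) u   ≡⟨ suffix-size u ⟩
    u                   ∎
    where open ≡-Reasoning

Splits-graftʳ : ∀ {t wl wr ul} → Splits t (wl ∨ wr) (ul ∨ wr) ⇔ Splits t wl ul
Splits-graftʳ {t} {wl} {wr} {ul} = mk⇔ ungraft graft
  where
  t≤ul : size ul ≡ size t + size wl → size t ≤ size ul
  t≤ul e = subst (size t ≤_) (sym e) (m≤m+n _ _)
  wl∨wr≡ : size (wl ∨ wr) ≡ suc (size wr + size wl)
  wl∨wr≡ = cong suc (+-comm (size wl) (size wr))

  ungraft : Splits t (wl ∨ wr) (ul ∨ wr) → Splits t wl ul
  ungraft (splits size≡ prefix≡ suffix≡) = splits size≡′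
    (trans (sym (prefix-within ul wr (t≤ul size≡′))) prefix≡)
    (∨-injectiveˡ (trans (sym (suffix-beyond ul wr (size wl) wl∨wr≡)) suffix≡))
    where
    size≡′ : size ul ≡ size t + size wl
    size≡′ = +-cancelʳ-≡ (size wr) _ _ (suc-injective (trans size≡ (+-suc-+ (size t) (size wl) (size wr))))

  graft : Splits t wl ul → Splits t (wl ∨ wr) (ul ∨ wr)
  graft (splits size≡ prefix≡ suffix≡) = splits
    (trans (cong (λ n → suc (n + size wr)) size≡) (sym (+-suc-+ (size t) (size wl) (size wr))))
    (trans (prefix-within ul wr (t≤ul size≡)) prefix≡)
    (trans (suffix-beyond ul wr (size wl) wl∨wr≡) (cong (_∨ wr) suffix≡))

Splits-graftˡ : ∀ {tl tr w ur} → Splits (tl ∨ tr) w (tl ∨ ur) ⇔ Splits tr w ur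
Splits-graftˡ {tl} {tr} {w} {ur} = mk⇔ ungraft graft
  where
  w≤ur : size ur ≡ size tr + size w → size w ≤ size ur
  w≤ur e = subst (size w ≤_) (sym e) (m≤n+m _ _)

  ungraft : Splits (tl ∨ tr) w (tl ∨ ur) → Splits tr w ur
  ungraft (splits size≡ prefix≡ suffix≡) = splits size≡′
    (∨-injectiveʳ (trans (sym (prefix-beyond tl ur (size tr) refl)) prefix≡))
    (trans (sym (suffix-within tl ur (w≤ur size≡′))) suffix≡)
    where
    size≡′ : size ur ≡ size tr + size w
    size≡′ = +-cancelˡ-≡ (size tl) _ _ (trans (suc-injective size≡) (+-assoc (size tl) (size tr) (size w)))

  graft : Splits tr w ur → Splits (tl ∨ tr) w (tl ∨ ur)
  graft (splits size≡ prefix≡ suffix≡) = splits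
    (cong suc (trans (cong (size tl +_) size≡) (sym (+-assoc (size tl) (size tr) (size w)))))
    (trans (prefix-beyond tl ur (size tr) refl) (cong (tl ∨_) prefix≡))
    (trans (suffix-within tl ur (w≤ur size≡)) suffix≡)

Splits-root : ∀ {tl tr wl wr ul ur} → Splits (tl ∨ tr) (wl ∨ wr) (ul ∨ ur) → ur ≡ wr ⊎ ul ≡ tl
Splits-root {tl} {tr} {wl} {wr} {ul} {ur} (splits size≡ prefix≡ suffix≡)
  with position (size (tl ∨ tr)) (size ul) | position (size (wl ∨ wr)) (size ur)
... | beyond j eq | _ = inj₂ (∨-injectiveˡ (trans (sym (prefix-beyond ul ur j eq)) prefix≡))
... | within _ | beyond i eq = inj₁ (∨-injectiveʳ (trans (sym (suffix-beyond ul ur i eq)) suffix≡))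
... | within t≤ul | within w≤ur =
  ⊥-elim (n≮n _ (subst (_≤ size ul + size ur) (sym size≡) (+-mono-≤ t≤ul w≤ur)))

Splits-∨ : ∀ {tl tr wl wr u} → Splits (tl ∨ tr) (wl ∨ wr) u ⇔
  ((∃[ a ] a ∨ wr ≡ u × Splits (tl ∨ tr) wl a) ⊎ (∃[ c ] tl ∨ c ≡ u × Splits tr (wl ∨ wr) c))
Splits-∨ {tl} {tr} {wl} {wr} = mk⇔ cases glue
  where
  glue : ∀ {u} →
    (∃[ a ] a ∨ wr ≡ u × Splits (tl ∨ tr) wl a) ⊎ (∃[ c ] tl ∨ c ≡ u × Splits tr (wl ∨ wr) c) →
    Splits (tl ∨ tr) (wl ∨ wr) u
  glue (inj₁ (_ , refl , s)) = from Splits-graftʳ s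
  glue (inj₂ (_ , refl , s)) = from Splits-graftˡ s
  cases : ∀ {u} → Splits (tl ∨ tr) (wl ∨ wr) u →
    (∃[ a ] a ∨ wr ≡ u × Splits (tl ∨ tr) wl a) ⊎ (∃[ c ] tl ∨ c ≡ u × Splits tr (wl ∨ wr) c)
  cases {leaf} (splits () _ _)
  cases {ul ∨ ur} s with Splits-root s
  ... | inj₁ refl = inj₁ (ul , refl , to Splits-graftʳ s)
  ... | inj₂ refl = inj₂ (ur , refl , to Splits-graftˡ s)

Splits-∨-disjoint : ∀ {tl tr wl wr u} →
  ¬ ((∃[ a ] a ∨ wr ≡ u × Splits (tl ∨ tr) wl a) × (∃[ c ] tl ∨ c ≡ u × Splits tr (wl ∨ wr) c))
Splits-∨-disjoint {tr = tr} {wl = wl} ((a , refl , s) , (_ , tl∨c≡a∨wr , _))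
  with ∨-injectiveˡ tl∨c≡a∨wr
... | refl = m≢1+m+n (size a) (trans (Splits.size≡ s) (cong suc (+-assoc (size a) (size tr) (size wl))))

Splits⇒InInterval : ∀ t w {u} → Splits t w u → InInterval t w u
Splits⇒InInterval t leaf s with to Splits-leafʳ s
... | refl = Splits.size≡ s , ≤w-refl , ≤w-reflexive (sym (\\-leaf t))
Splits⇒InInterval leaf w@(_ ∨ _) s with to Splits-leafˡ s
... | refl = Splits.size≡ s , ≤w-reflexive (leaf-/ w) , ≤w-refl
Splits⇒InInterval t@(tl ∨ tr) w@(wl ∨ wr) s with to Splits-∨ s
... | inj₁ (a , refl , s′) with Splits⇒InInterval t wl s′
...   | _ , lower , upper =
  Splits.size≡ s , ≤w-graft lower ≤w-refl , ≤w-trans (≤w-graft upper ≤w-refl) (\\-∨-≤w t wl wr)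
Splits⇒InInterval t@(tl ∨ tr) w@(wl ∨ wr) s | inj₂ (c , refl , s′) with Splits⇒InInterval tr w s′
...   | _ , lower , upper =
  Splits.size≡ s , ≤w-trans (∨-/-≤w tl tr w) (≤w-graft ≤w-refl lower) , ≤w-graft ≤w-refl upper

InInterval⇒Splits : ∀ {t w u} → InInterval t w u → Splits t w u
InInterval⇒Splits {t} {w} {u} (size≡ , lower , upper) = splits size≡
  (≤w-antisym (subst (prefix (size t) u ≤w_) (prefix-\\ t w) (prefix-mono (size t) upper))
              (subst (_≤w prefix (size t) u) (prefix-/ t w) (prefix-mono (size t) lower)))
  (≤w-antisym (subst (suffix (size w) u ≤w_) (suffix-\\ t w) (suffix-mono (size w) upper))
              (subst (_≤w suffix (size w) u) (suffix-/ t w) (suffix-mono (size w) lower)))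

InInterval⇔Splits : ∀ t w {u} → InInterval t w u ⇔ Splits t w u
InInterval⇔Splits t w = mk⇔ InInterval⇒Splits (Splits⇒InInterval t w)

Indicator : Set → ℚ → Set
Indicator P x = (P → x ≡ 1ℚ) × (¬ P → x ≡ 0ℚ)

Indicator-resp-⇔ : ∀ {P Q x} → Q ⇔ P → Indicator P x → Indicator Q x
Indicator-resp-⇔ Q⇔P (is-one , is-zero) = is-one ∘ to Q⇔P , λ ¬q → is-zero (¬q ∘ from Q⇔P)

Indicator-⊎ : ∀ {P Q x y} → Indicator P x → Indicator Q y → ¬ (P × Q) →
  Indicator (P ⊎ Q) (x +ℚ y)
Indicator-⊎ {P} {Q} {x} {y} (p₁ , p₀) (q₁ , q₀) disjoint = is-one , is-zero
  where
  is-one : P ⊎ Q → x +ℚ y ≡ 1ℚ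
  is-one (inj₁ p) = trans (cong₂ _+ℚ_ (p₁ p) (q₀ (λ q → disjoint (p , q)))) (ℚ.+-identityʳ 1ℚ)
  is-one (inj₂ q) = trans (cong₂ _+ℚ_ (p₀ (λ p → disjoint (p , q))) (q₁ q)) (ℚ.+-identityˡ 1ℚ)
  is-zero : ¬ (P ⊎ Q) → x +ℚ y ≡ 0ℚ
  is-zero ¬p⊎q = trans (cong₂ _+ℚ_ (p₀ (¬p⊎q ∘ inj₁)) (q₀ (¬p⊎q ∘ inj₂))) (ℚ.+-identityˡ 0ℚ)

coeff-++ : ∀ xs ys u → coeff (xs ++ ys) u ≡ coeff xs u +ℚ coeff ys u
coeff-++ [] ys u = sym (ℚ.+-identityˡ _)
coeff-++ ((c , s) ∷ xs) ys u with s ≟T u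
... | yes _ = trans (cong (c +ℚ_) (coeff-++ xs ys u)) (sym (ℚ.+-assoc c _ _))
... | no _ = coeff-++ xs ys u

coeff-singleton : ∀ s u → Indicator (s ≡ u) (coeff ((1ℚ , s) ∷ []) u)
coeff-singleton s u with s ≟T u
... | yes s≡u = (λ _ → ℚ.+-identityʳ 1ℚ) , λ s≢u → ⊥-elim (s≢u s≡u)
... | no s≢u = (λ s≡u → ⊥-elim (s≢u s≡u)) , λ _ → refl

mapTrees : (Tree → Tree) → QY → QY
mapTrees g = map (map₂ g)

∨ₗ-mapTrees : ∀ X b → X ∨ₗ b ≡ mapTrees (_∨ b) X
∨ₗ-mapTrees [] b = refl
∨ₗ-mapTrees (x ∷ X) b = cong (_ ∷_) (∨ₗ-mapTrees X b)

∨ᵣ-mapTrees : ∀ a Y → a ∨ᵣ Y ≡ mapTrees (a ∨_) Y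
∨ᵣ-mapTrees a [] = refl
∨ᵣ-mapTrees a (y ∷ Y) = cong (_ ∷_) (∨ᵣ-mapTrees a Y)

coeff-mapTrees : ∀ {g} → Injective _≡_ _≡_ g → ∀ X a → coeff (mapTrees g X) (g a) ≡ coeff X a
coeff-mapTrees g-inj [] a = refl
coeff-mapTrees {g} g-inj ((c , s) ∷ X) a with g s ≟T g a | s ≟T a
... | yes _ | yes _ = cong (c +ℚ_) (coeff-mapTrees g-inj X a)
... | no _ | no _ = coeff-mapTrees g-inj X a
... | yes gs≡ga | no s≢a = ⊥-elim (s≢a (g-inj gs≡ga))
... | no gs≢ga | yes s≡a = ⊥-elim (gs≢ga (cong g s≡a))

coeff-mapTrees-∉ : ∀ {g u} → (∀ a → g a ≢ u) → ∀ X → coeff (mapTrees g X) u ≡ 0ℚ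
coeff-mapTrees-∉ ∉ [] = refl
coeff-mapTrees-∉ {g} {u} ∉ ((c , s) ∷ X) with g s ≟T u
... | yes gs≡u = ⊥-elim (∉ s gs≡u)
... | no _ = coeff-mapTrees-∉ ∉ X

Indicator-mapTrees : ∀ {g} {P : Tree → Set} X →
  Injective _≡_ _≡_ g → (∀ u → Dec (∃[ a ] g a ≡ u)) →
  (∀ a → Indicator (P a) (coeff X a)) →
  ∀ u → Indicator (∃[ a ] g a ≡ u × P a) (coeff (mapTrees g X) u)
Indicator-mapTrees {g} {P} X g-inj image? ind u with image? u
... | yes (a , refl) =
  subst (Indicator _) (sym (coeff-mapTrees g-inj X a)) (Indicator-resp-⇔ fibre⇔ (ind a))
  where
  fibre⇔ : (∃[ a′ ] g a′ ≡ g a × P a′) ⇔ P a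
  fibre⇔ = mk⇔ (λ { (_ , ga′≡ga , p) → subst P (g-inj ga′≡ga) p }) (λ p → a , refl , p)
... | no ∉ =
  (λ { (a , ga≡u , _) → ⊥-elim (∉ (a , ga≡u)) }) , λ _ → coeff-mapTrees-∉ (λ a ga≡u → ∉ (a , ga≡u)) X

has-right-subtree? : ∀ b u → Dec (∃[ a ] a ∨ b ≡ u)
has-right-subtree? b leaf = no λ { (_ , ()) }
has-right-subtree? b (c ∨ d) with b ≟T d
... | yes refl = yes (c , refl)
... | no b≢d = no λ { (_ , a∨b≡c∨d) → b≢d (∨-injectiveʳ a∨b≡c∨d) }

has-left-subtree? : ∀ a u → Dec (∃[ c ] a ∨ c ≡ u)
has-left-subtree? a leaf = no λ { (_ , ()) }
has-left-subtree? a (c ∨ d) with a ≟T c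
... | yes refl = yes (d , refl)
... | no a≢c = no λ { (_ , a∨b≡c∨d) → a≢c (∨-injectiveˡ a∨b≡c∨d) }

Indicator-∨ₗ : ∀ {P : Tree → Set} X b → (∀ a → Indicator (P a) (coeff X a)) →
  ∀ u → Indicator (∃[ a ] a ∨ b ≡ u × P a) (coeff (X ∨ₗ b) u)
Indicator-∨ₗ X b ind u rewrite ∨ₗ-mapTrees X b =
  Indicator-mapTrees X ∨-injectiveˡ (has-right-subtree? b) ind u

Indicator-∨ᵣ : ∀ {P : Tree → Set} a Y → (∀ c → Indicator (P c) (coeff Y c)) →
  ∀ u → Indicator (∃[ c ] a ∨ c ≡ u × P c) (coeff (a ∨ᵣ Y) u)
Indicator-∨ᵣ a Y ind u rewrite ∨ᵣ-mapTrees a Y =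
  Indicator-mapTrees Y ∨-injectiveʳ (has-left-subtree? a) ind u

coeff-*-Splits : ∀ t w u → Indicator (Splits t w u) (coeff (t * w) u)
coeff-*-Splits t leaf u = Indicator-resp-⇔ Splits-leafʳ (coeff-singleton t u)
coeff-*-Splits leaf w@(_ ∨ _) u = Indicator-resp-⇔ Splits-leafˡ (coeff-singleton w u)
coeff-*-Splits t@(tl ∨ tr) w@(wl ∨ wr) u =
  Indicator-resp-⇔ Splits-∨ $
  subst (Indicator _) (sym (coeff-++ ((t * wl) ∨ₗ wr) (tl ∨ᵣ (tr * w)) u)) $
  Indicator-⊎ (Indicator-∨ₗ (t * wl) wr (coeff-*-Splits t wl) u)
              (Indicator-∨ᵣ tl (tr * w) (coeff-*-Splits tr w) u)
              Splits-∨-disjoint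

theorem5p1 : (p q : ℕ) (t w : Tree) → size t ≡ p → size w ≡ q →
    (u : Tree) → (InInterval t w u → coeff (t * w) u ≡ 1ℚ) × (¬ InInterval t w u → coeff (t * w) u ≡ 0ℚ)
theorem5p1 _ _ t w _ _ u = Indicator-resp-⇔ (InInterval⇔Splits t w) (coeff-*-Splits t w u)
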